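{- Let $\Delta$ be a finite chamber complex, and for each chamber $C$ define the relation $\le_C$ on chambers by: $D\le_C E$ iff there is a geodesic gallery from $C$ to $E$ passing through $D$. Then the following are equivalent: (a) $\Delta$ has the gate property; (b) the partial orders $\le_C$ ($C$ a chamber) satisfy the shelling axioms (S1)–(S3); (c) for every face $F$ and chamber $C$ there is a unique chamber $FC$ containing $F$ at minimal gallery distance from $C$, and the resulting map $(F,C)\mapsto FC$ satisfies the projection axioms (P1)–(P3). Moreover, when these hold, the maps $R_C$, where $R_C(D)$ is the face of $D$ spanned by the vertices $v$ of $D$ with $(D\setminus v)C\ne D$, satisfy the restriction axioms (R1)–(R3).
   Context: A chamber complex is a finite pure simplicial complex (chambers = maximal faces) that is gallery connected: two chambers are adjacent if they share a codimension-one face, a gallery is a sequence of chambers with consecutive ones adjacent, and any two chambers are joined by a gallery. The gallery distance $d(C,D)$ is the minimal length of a gallery from $C$ to $D$; a gallery achieving it is geodesic. Gate property: for every face $F$ and chamber $C$ there is a chamber $D\supseteq F$ with $d(C,E)=d(C,D)+d(D,E)$ for every chamber $E\supseteq F$. $D\setminus v$ is the codimension-one face of $D$ not containing the vertex $v$. $\mathcal{F}$ denotes the faces (including $\emptyset$), $\mathcal{C}$ the chambers, $\le$ the face relation, $G\lessdot D$ a codimension-one face, $\mathcal{C}_{\ge F}$ the chambers containing $F$; a shelling is a linear order on chambers such that each chamber other than the first meets the union of the earlier ones in a nonempty union of its codimension-one faces. Axioms: (P1)(i) $FC=D\Rightarrow F\le D$; (ii) $F\le C\Rightarrow FC=C$;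 (iii) $FC=D$, $F\le G\le D\Rightarrow GC=D$. (P2) if $F\le D$ and $GC=D$ for all $F\le G\lessdot D$ then $FC=D$. (P3) if $FC=D$ and $C_1,\dots,C_n=D$ is a weak $C$-gallery (faces $F_i$ with $F_iC=C_i$, $F_i\le C_i,C_{i+1}$) then $FC_1=D$. (R1) $R_C(C)=\emptyset$, $R_C(D)\le D$; (R2) for each $C$, $\mathcal{F}=\bigsqcup_{D}\{F: R_C(D)\le F\le D\}$; (R3) if $R_C(C_i)\le C_{i+1}$ for $1\le i<n$ and $C_n=D$ then $R_{C_1}(D)\le R_C(D)\le D$. (S1) for each $F$, $\le_C$ restricted to $\mathcal{C}_{\ge F}$ has a unique minimal element, equal to $C$ when $F=\emptyset$; (S2) every linear extension of $\le_C$ is a shelling of $\Delta$; (S3) $D\le_C D_1\le_C D_2\Rightarrow D_1\le_D D_2$. -}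

module Defs where

open import Data.Nat using (ℕ; zero; suc; _+_; _≤_; _<_)
open import Data.Bool using (Bool; true; false)
open import Data.Fin using (Fin; toℕ)
open import Data.Fin.Subset using (Subset; _⊆_; _∈_; _∉_; ⊥; ∣_∣; _-_)
open import Data.List using (List; length; lookup)
open import Data.List.Relation.Unary.Unique.Propositional using (Unique)
import Data.List.Membership.Propositional as LM
open import Data.Product using (Σ; ∃; ∃-syntax; _×_; _,_)
open import Relation.Binary.PropositionalEquality using (_≡_; _≢_)
open import Relation.Nullary using (¬_)
open import Function.Bundles using (_⇔_)

record SimplicialComplex : Set where
  field
    n      : ℕ
    face   : Subset n → Bool
    face-∅ : face ⊥ ≡ true
    down   : ∀ (F G : Subset n) → G ⊆ F → face F ≡ true → face G ≡ true

module _ (Δ : SimplicialComplex) where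
  open SimplicialComplex Δ

  IsFace : Subset n → Set
  IsFace F = face F ≡ true

  IsChamber : Subset n → Set
  IsChamber C = IsFace C × (∀ (F : Subset n) → IsFace F → C ⊆ F → F ≡ C)

  CodimOne : Subset n → Subset n → Set
  CodimOne G D = G ⊆ D × suc ∣ G ∣ ≡ ∣ D ∣

  Adjacent : Subset n → Subset n → Set
  Adjacent C D = IsChamber C × IsChamber D × C ≢ D
               × ∃[ G ] (CodimOne G C × CodimOne G D)

  data Gallery : Subset n → Subset n → ℕ → Set where
    gnil  : ∀ {C} → IsChamber C → Gallery C C 0
    gcons : ∀ {C D E k} → Adjacent C D → Gallery D E k → Gallery C E (suc k)

  Through : ∀ {C E k} → Gallery C E k → Subset n → Set
  Through (gnil {C} _) D = D ≡ C
  Through (gcons {C} _ g) D = (D ≡ C) Data.Sum.⊎ Through g D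
    where import Data.Sum

  IsPure : Set
  IsPure = ∀ C D → IsChamber C → IsChamber D → ∣ C ∣ ≡ ∣ D ∣

  IsGalleryConnected : Set
  IsGalleryConnected = ∀ C D → IsChamber C → IsChamber D → ∃[ k ] Gallery C D k

  -- finite chamber complex = pure + gallery connected (finiteness is built in)
  IsChamberComplex : Set
  IsChamberComplex = IsPure × IsGalleryConnected

  Dist : Subset n → Subset n → ℕ → Set
  Dist C D k = Gallery C D k × (∀ m → Gallery C D m → k ≤ m)

  Geodesic : ∀ {C E k} → Gallery C E k → Set
  Geodesic {C} {E} {k} _ = Dist C E k

  GateProperty : Set
  GateProperty =
    ∀ F C → IsFace F → IsChamber C →
      ∃[ D ] (IsChamber D × F ⊆ D ×
        (∀ E → IsChamber E → F ⊆ E →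
          ∀ a b c → Dist C E a → Dist C D b → Dist D E c → a ≡ b + c))

  _≤[_]_ : Subset n → Subset n → Subset n → Set
  D ≤[ C ] E = Σ ℕ λ k → Σ (Gallery C E k) λ g → Geodesic g × Through g D

  MinimalIn : Subset n → Subset n → Subset n → Set
  MinimalIn C F D = IsChamber D × F ⊆ D ×
    (∀ E → IsChamber E → F ⊆ E → E ≤[ C ] D → E ≡ D)

  S1 : Set
  S1 = ∀ C F → IsChamber C → IsFace F →
         ∃[ D ] (MinimalIn C F D × (∀ D′ → MinimalIn C F D′ → D′ ≡ D)
                  × (F ≡ ⊥ → D ≡ C))

  -- a linear order on the chambers, as a duplicate-free list of all chambers
  IsChamberOrder : List (Subset n) → Set
  IsChamberOrder L = Unique L × (∀ D → (IsChamber D ⇔ D LM.∈ L))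

  IsLinearExtension : Subset n → List (Subset n) → Set
  IsLinearExtension C L = IsChamberOrder L ×
    (∀ i j → lookup L i ≤[ C ] lookup L j → toℕ i ≤ toℕ j)

  -- shelling: every chamber other than the first meets the union of the
  -- earlier ones in a nonempty union of its codimension-one faces
  IsShelling : List (Subset n) → Set
  IsShelling L = IsChamberOrder L ×
    (∀ j → 0 < toℕ j →
       (∃[ G ] (CodimOne G (lookup L j) ×
                ∃[ i ] (toℕ i < toℕ j × G ⊆ lookup L i)))
     × (∀ F → F ⊆ lookup L j → ∀ i → toℕ i < toℕ j → F ⊆ lookup L i →
          ∃[ G ] (CodimOne G (lookup L j) × F ⊆ G ×
                  ∃[ k ] (toℕ k < toℕ j × G ⊆ lookup L k))))

  S2 : Set
  S2 = ∀ C → IsChamber C → ∀ L → IsLinearExtension C L → IsShelling L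

  S3 : Set
  S3 = ∀ C D D₁ D₂ → IsChamber C → IsChamber D → IsChamber D₁ → IsChamber D₂ →
         D ≤[ C ] D₁ → D₁ ≤[ C ] D₂ → D₁ ≤[ D ] D₂

  ShellingAxioms : Set
  ShellingAxioms = S1 × S2 × S3

  MinDistChamber : Subset n → Subset n → Subset n → Set
  MinDistChamber F C D = IsChamber D × F ⊆ D ×
    ∃[ k ] (Dist C D k × (∀ E → IsChamber E → F ⊆ E → ∀ m → Dist C E m → k ≤ m))

  IsProjection : (Subset n → Subset n → Subset n) → Set
  IsProjection proj = ∀ F C → IsFace F → IsChamber C →
    MinDistChamber F C (proj F C) × (∀ D → MinDistChamber F C D → D ≡ proj F C)

  module _ (proj : Subset n → Subset n → Subset n) where

    P1 : Set
    P1 = (∀ F C → IsFace F → IsChamber C → F ⊆ proj F C)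
       × (∀ F C → IsFace F → IsChamber C → F ⊆ C → proj F C ≡ C)
       × (∀ F G C → IsFace F → IsFace G → IsChamber C →
            F ⊆ G → G ⊆ proj F C → proj G C ≡ proj F C)

    P2 : Set
    P2 = ∀ F C D → IsFace F → IsChamber C → IsChamber D → F ⊆ D →
           (∀ G → F ⊆ G → CodimOne G D → proj G C ≡ D) → proj F C ≡ D

    data WeakGallery (C : Subset n) : Subset n → Subset n → Set where
      wnil  : ∀ {D} → IsChamber D → WeakGallery C D D
      wcons : ∀ {C₁ C₂ D} (G : Subset n) → IsChamber C₁ → IsFace G →
              proj G C ≡ C₁ → G ⊆ C₁ → G ⊆ C₂ →
              WeakGallery C C₂ D → WeakGallery C C₁ D

    P3 : Set
    P3 = ∀ F C C₁ D → IsFace F → IsChamber C →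
           proj F C ≡ D → WeakGallery C C₁ D → proj F C₁ ≡ D

    ProjectionAxioms : Set
    ProjectionAxioms = P1 × P2 × P3

    IsRestrictionMap : (Subset n → Subset n → Subset n) → Set
    IsRestrictionMap R = ∀ C D → IsChamber C → IsChamber D →
      ∀ v → (v ∈ R C D ⇔ (v ∈ D × proj (D - v) C ≢ D))

  module _ (R : Subset n → Subset n → Subset n) where

    R1 : Set
    R1 = ∀ C D → IsChamber C → IsChamber D → R C C ≡ ⊥ × R C D ⊆ D

    R2 : Set
    R2 = ∀ C F → IsChamber C → IsFace F →
           ∃[ D ] ((IsChamber D × R C D ⊆ F × F ⊆ D)
                   × (∀ D′ → IsChamber D′ → R C D′ ⊆ F → F ⊆ D′ → D′ ≡ D))

    data RChain (C : Subset n) : Subset n → Subset n → Set where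
      rnil  : ∀ {D} → IsChamber D → RChain C D D
      rcons : ∀ {C₁ C₂ D} → IsChamber C₁ → R C C₁ ⊆ C₂ →
              RChain C C₂ D → RChain C C₁ D

    R3 : Set
    R3 = ∀ C C₁ D → IsChamber C → RChain C C₁ D → R C₁ D ⊆ R C D × R C D ⊆ D

    RestrictionAxioms : Set
    RestrictionAxioms = R1 × R2 × R3

{-# OPTIONS --safe #-}
-- D ≤_C E just says d(C,D) + d(D,E) = d(C,E) for the gallery metric d, so (S3) holds in any
-- metric space, and a gate of F for C is a chamber D ⊇ F with D ≤_C E for every chamber E ⊇ F.
-- Gates make C_{≥F} convex: if Z lies between chambers X, Y ⊇ F and Q is the gate of F for Z,
-- then d(X,Y) ≥ 2 d(Z,Q) + d(X,Y), so Z = Q ⊇ F. Hence every chamber D ⊇ F other than the gate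
-- has a neighbour one step nearer to C that still contains F; this yields (P2), (S2) and the
-- uniqueness in (R2). (P3) and (R3) hold because the gate of G for C is also its gate for every
-- chamber on a geodesic from C to it. Conversely, (S1), or uniqueness of nearest chambers with
-- (P2), supplies for every chamber E ⊇ F other than the candidate D a strictly nearer chamber
-- E′ ⊇ F with E′ ≤_C E, and induction on d(C,E) makes D a gate.
module Submission where

open import Defs
open import Data.Bool using (true)
import Data.Bool.Properties as Bool
open import Data.Fin using (Fin; toℕ; fromℕ<)
open import Data.Fin.Properties using (any?; toℕ<n; toℕ-fromℕ<; toℕ-injective)
open import Data.Fin.Subset using (Subset; _⊆_; _∈_; _∉_; ⊥; ∣_∣; _-_; _∩_; inside; outside)
open import Data.Fin.Subset.Properties
open import Data.List using (lookup)
open import Data.List.Membership.Propositional.Properties using (∈-lookup)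
open import Data.List.Relation.Unary.Any using (index)
open import Data.List.Relation.Unary.Any.Properties using (lookup-index)
open import Data.Nat using (ℕ; zero; suc; _+_; _≤_; _<_; z≤n; s≤s)
open import Data.Nat.Induction using (<-wellFounded)
open import Data.Nat.Properties
open import Algebra.Properties.CommutativeSemigroup +-commutativeSemigroup using (interchange)
open import Data.Product using (Σ; ∃; ∃₂; ∃-syntax; _×_; _,_; proj₁; proj₂)
open import Data.Sum using (inj₁; inj₂)
open import Data.Vec using ([]; _∷_; here)
open import Data.Vec.Properties using (≡-dec)
open import Function using (_∘_)
open import Function.Bundles using (_⇔_; mk⇔; Equivalence)
open import Induction.WellFounded using (Acc; acc)
open import Relation.Binary.Definitions using (DecidableEquality)
open import Relation.Binary.PropositionalEquality
open import Relation.Nullary using (Dec; yes; no; contradiction)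
open import Relation.Nullary.Decidable using (_×-dec_; _→-dec_; ¬?; decidable-stable)
open import Relation.Unary using (Pred; Decidable)

m+n≤m⇒n≡0 : ∀ m {n} → m + n ≤ m → n ≡ 0
m+n≤m⇒n≡0 m le = n≤0⇒n≡0 (+-cancelˡ-≤ m _ 0 (subst (m + _ ≤_) (sym (+-identityʳ m)) le))

m+n≤n⇒m≡0 : ∀ m {n} → m + n ≤ n → m ≡ 0
m+n≤n⇒m≡0 m {n} le = m+n≤m⇒n≡0 n (subst (_≤ n) (+-comm m n) le)

least-witness : ∀ {p} {P : Pred ℕ p} → Decidable P → ∀ {k} → P k →
                ∃[ m ] (P m × (∀ j → P j → m ≤ j))
least-witness {P = P} P? {k} = go k (<-wellFounded k)
  where
  go : ∀ k → Acc _<_ k → P k → ∃[ m ] (P m × (∀ j → P j → m ≤ j))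
  go k (acc smaller) pk with any? (λ (j : Fin k) → P? (toℕ j))
  ... | yes (j , pj) = go (toℕ j) (smaller (toℕ<n j)) pj
  ... | no none      = k , pk , λ j pj →
    ≮⇒≥ λ j<k → none (fromℕ< j<k , subst P (sym (toℕ-fromℕ< j<k)) pj)

_≟ₛ_ : ∀ {n} → DecidableEquality (Subset n)
_≟ₛ_ = ≡-dec Bool._≟_

allSubset? : ∀ {n p} {P : Pred (Subset n) p} → Decidable P → Dec (∀ x → P x)
allSubset? P? with anySubset? (¬? ∘ P?)
... | yes (x , ¬px) = no λ all → ¬px (all x)
... | no none       = yes λ x → decidable-stable (P? x) λ ¬px → none (x , ¬px)

p⊆q∧∣q∣≤∣p∣⇒p≡q : ∀ {n} {p q : Subset n} → p ⊆ q → ∣ q ∣ ≤ ∣ p ∣ → p ≡ q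
p⊆q∧∣q∣≤∣p∣⇒p≡q {p = []}          {[]}          _   _       = refl
p⊆q∧∣q∣≤∣p∣⇒p≡q {p = outside ∷ p} {outside ∷ q} p⊆q ∣q∣≤∣p∣ =
  cong (outside ∷_) (p⊆q∧∣q∣≤∣p∣⇒p≡q (drop-∷-⊆ p⊆q) ∣q∣≤∣p∣)
p⊆q∧∣q∣≤∣p∣⇒p≡q {p = inside ∷ p}  {inside ∷ q}  p⊆q (s≤s ∣q∣≤∣p∣) =
  cong (inside ∷_) (p⊆q∧∣q∣≤∣p∣⇒p≡q (drop-∷-⊆ p⊆q) ∣q∣≤∣p∣)
p⊆q∧∣q∣≤∣p∣⇒p≡q {p = inside ∷ p}  {outside ∷ q} p⊆q _ with p⊆q (here {xs = p})
... | ()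
p⊆q∧∣q∣≤∣p∣⇒p≡q {p = outside ∷ p} {inside ∷ q}  p⊆q ∣q∣≤∣p∣ =
  contradiction ∣q∣≤∣p∣ (<⇒≱ (s≤s (p⊆q⇒∣p∣≤∣q∣ (drop-∷-⊆ p⊆q))))

p⊆q∧1+∣p∣≡∣q∣⇒p≡q-x : ∀ {n} {p q : Subset n} → p ⊆ q → suc ∣ p ∣ ≡ ∣ q ∣ →
                       ∃[ x ] (x ∈ q × x ∉ p × p ≡ q - x)
p⊆q∧1+∣p∣≡∣q∣⇒p≡q-x {p = p} {q} p⊆q 1+∣p∣≡∣q∣ with any? (λ x → x ∈? q ×-dec ¬? (x ∈? p))
... | yes (x , x∈q , x∉p) = x , x∈q , x∉p , p⊆q∧∣q∣≤∣p∣⇒p≡q p⊆q-x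
        (≤-pred (subst (∣ q - x ∣ <_) (sym 1+∣p∣≡∣q∣) (x∈p⇒∣p-x∣<∣p∣ x∈q)))
  where
  p⊆q-x : p ⊆ q - x
  p⊆q-x y∈p = x∈p∧x≢y⇒x∈p-y (p⊆q y∈p) λ { refl → x∉p y∈p }
... | no none = contradiction (p⊆q⇒∣p∣≤∣q∣ q⊆p) (<⇒≱ (≤-reflexive 1+∣p∣≡∣q∣))
  where
  q⊆p : q ⊆ p
  q⊆p {x} x∈q = decidable-stable (x ∈? p) λ x∉p → none (x , x∈q , x∉p)

module ChamberComplex (Δ : SimplicialComplex) (pure : IsPure Δ)
                      (connected : IsGalleryConnected Δ) where
  open SimplicialComplex Δ using (n; face; down)

  Face : Subset n → Set
  Face = IsFace Δ

  Chamber : Subset n → Set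
  Chamber = IsChamber Δ

  face-⊆ : ∀ {F G} → Face G → F ⊆ G → Face F
  face-⊆ {F} {G} g F⊆G = down G F F⊆G g

  chamber-face : ∀ {C} → Chamber C → Face C
  chamber-face = proj₁

  face? : Decidable Face
  face? F = face F Bool.≟ true

  chamber? : Decidable Chamber
  chamber? C = face? C ×-dec allSubset? λ F → face? F →-dec (C ⊆? F →-dec F ≟ₛ C)

  codimOne? : ∀ G D → Dec (CodimOne Δ G D)
  codimOne? G D = G ⊆? D ×-dec (suc ∣ G ∣ ≟ ∣ D ∣)

  adjacent? : ∀ C D → Dec (Adjacent Δ C D)
  adjacent? C D = chamber? C ×-dec chamber? D ×-dec ¬? (C ≟ₛ D)
           ×-dec anySubset? λ G → codimOne? G C ×-dec codimOne? G D

  gallery? : ∀ k C D → Dec (Gallery Δ C D k)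
  gallery? zero C D with C ≟ₛ D | chamber? C
  ... | yes refl | yes c = yes (gnil c)
  ... | yes refl | no ¬c = no λ { (gnil c) → ¬c c }
  ... | no C≢D   | _     = no λ { (gnil _) → C≢D refl }
  gallery? (suc k) C D with anySubset? (λ X → adjacent? C X ×-dec gallery? k X D)
  ... | yes (_ , a , g) = yes (gcons a g)
  ... | no none         = no λ { (gcons a g) → none (_ , a , g) }

  adjacent-sym : ∀ {C D} → Adjacent Δ C D → Adjacent Δ D C
  adjacent-sym (c , e , C≢D , G , G⋖C , G⋖D) = e , c , C≢D ∘ sym , G , G⋖D , G⋖C

  common-panel⇒adjacent : ∀ {G X Y} → Chamber X → Chamber Y → X ≢ Y →
                          G ⊆ X → CodimOne Δ G Y → Adjacent Δ X Y
  common-panel⇒adjacent x y X≢Y G⊆X (G⊆Y , G⋖Y) =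
    x , y , X≢Y , _ , (G⊆X , trans G⋖Y (pure _ _ y x)) , (G⊆Y , G⋖Y)

  adjacent⇒codimOne-∩ : ∀ {X D} → Adjacent Δ X D → CodimOne Δ (D ∩ X) D
  adjacent⇒codimOne-∩ {X} {D} (x , e , X≢D , G , (G⊆X , _) , (G⊆D , G⋖D)) =
    p∩q⊆p D X , ≤-antisym ∣D∩X∣<∣D∣ (subst (_≤ suc ∣ D ∩ X ∣) G⋖D (s≤s (p⊆q⇒∣p∣≤∣q∣ G⊆D∩X)))
    where
    G⊆D∩X : G ⊆ D ∩ X
    G⊆D∩X v∈G = x∈p∩q⁺ (G⊆D v∈G , G⊆X v∈G)
    ∣D∩X∣<∣D∣ : ∣ D ∩ X ∣ < ∣ D ∣
    ∣D∩X∣<∣D∣ = ≰⇒> λ ∣D∣≤∣D∩X∣ →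
      let D∩X≡D = p⊆q∧∣q∣≤∣p∣⇒p≡q (p∩q⊆p D X) ∣D∣≤∣D∩X∣
      in X≢D (proj₂ e X (proj₁ x) λ v∈D → p∩q⊆q D X (subst (_ ∈_) (sym D∩X≡D) v∈D))

  gallery-source : ∀ {C D k} → Gallery Δ C D k → Chamber C
  gallery-source (gnil c)    = c
  gallery-source (gcons a _) = proj₁ a

  gallery-target : ∀ {C D k} → Gallery Δ C D k → Chamber D
  gallery-target (gnil c)    = c
  gallery-target (gcons _ g) = gallery-target g

  gallery-0⇒≡ : ∀ {C D} → Gallery Δ C D 0 → C ≡ D
  gallery-0⇒≡ (gnil _) = refl

  _++ᵍ_ : ∀ {C D E k m} → Gallery Δ C D k → Gallery Δ D E m → Gallery Δ C E (k + m)
  gnil _    ++ᵍ h = h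
  gcons a g ++ᵍ h = gcons a (g ++ᵍ h)

  reverse : ∀ {C D k} → Gallery Δ C D k → Gallery Δ D C k
  reverse (gnil c) = gnil c
  reverse {k = suc k} (gcons a g) =
    subst (Gallery Δ _ _) (+-comm k 1) (reverse g ++ᵍ gcons (adjacent-sym a) (gnil (proj₁ a)))

  through-source : ∀ {D E m} (g : Gallery Δ D E m) → Through Δ g D
  through-source (gnil _)    = refl
  through-source (gcons _ _) = inj₁ refl

  through-++ : ∀ {C D E k m} (g : Gallery Δ C D k) (h : Gallery Δ D E m) → Through Δ (g ++ᵍ h) D
  through-++ (gnil _)    h = through-source h
  through-++ (gcons _ g) h = inj₂ (through-++ g h)

  through-split : ∀ {C D E k} (g : Gallery Δ C E k) → Through Δ g D →
                  ∃₂ λ k₁ k₂ → Gallery Δ C D k₁ × Gallery Δ D E k₂ × k₁ + k₂ ≡ k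
  through-split (gnil c)      refl        = 0 , 0 , gnil c , gnil c , refl
  through-split g@(gcons a _) (inj₁ refl) = 0 , _ , gnil (proj₁ a) , g , refl
  through-split (gcons a g)   (inj₂ t) with through-split g t
  ... | k₁ , k₂ , g₁ , g₂ , eq = suc k₁ , k₂ , gcons a g₁ , g₂ , cong suc eq

  private
    distance : ∀ {C D} → Chamber C → Chamber D → Σ ℕ (Dist Δ C D)
    distance {C} {D} c e = least-witness (λ k → gallery? k C D) (proj₂ (connected C D c e))

  -- Kept abstract so that a with on chamber? elsewhere does not also rewrite inside d.
  abstract
    d : Subset n → Subset n → ℕ
    d C D with chamber? C | chamber? D
    ... | yes c | yes e = proj₁ (distance c e)
    ... | _     | _     = 0

    d-dist : ∀ {C D} → Chamber C → Chamber D → Dist Δ C D (d C D)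
    d-dist {C} {D} c e with chamber? C | chamber? D
    ... | yes c′ | yes e′ = proj₂ (distance c′ e′)
    ... | no ¬c  | _      = contradiction c ¬c
    ... | yes _  | no ¬e  = contradiction e ¬e

  d-gallery : ∀ {C D} → Chamber C → Chamber D → Gallery Δ C D (d C D)
  d-gallery c e = proj₁ (d-dist c e)

  d-≤ : ∀ {C D k} → Gallery Δ C D k → d C D ≤ k
  d-≤ g = proj₂ (d-dist (gallery-source g) (gallery-target g)) _ g

  Dist⇒≡d : ∀ {C D k} → Dist Δ C D k → k ≡ d C D
  Dist⇒≡d (g , minimal) =
    ≤-antisym (minimal _ (d-gallery (gallery-source g) (gallery-target g))) (d-≤ g)

  d-refl : ∀ {C} → Chamber C → d C C ≡ 0
  d-refl c = n≤0⇒n≡0 (d-≤ (gnil c))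

  d≡0⇒≡ : ∀ {C D} → Chamber C → Chamber D → d C D ≡ 0 → C ≡ D
  d≡0⇒≡ c e d≡0 = gallery-0⇒≡ (subst (Gallery Δ _ _) d≡0 (d-gallery c e))

  d-sym : ∀ {C D} → Chamber C → Chamber D → d C D ≡ d D C
  d-sym c e = ≤-antisym (d-≤ (reverse (d-gallery e c))) (d-≤ (reverse (d-gallery c e)))

  d-triangle : ∀ {C D E} → Chamber C → Chamber D → Chamber E → d C E ≤ d C D + d D E
  d-triangle c x e = d-≤ (d-gallery c x ++ᵍ d-gallery x e)

  d-adjacent : ∀ {C D} → Adjacent Δ C D → d C D ≡ 1
  d-adjacent a@(c , e , C≢D , _) =
    ≤-antisym (d-≤ (gcons a (gnil e))) (n≢0⇒n>0 (C≢D ∘ d≡0⇒≡ c e))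

  d-first-step : ∀ {C D k} → Chamber C → Chamber D → d C D ≡ suc k →
                 ∃[ X ] (Adjacent Δ C X × d X D ≡ k)
  d-first-step {C} {D} c e CD≡1+k with subst (Gallery Δ C D) CD≡1+k (d-gallery c e)
  ... | gcons {D = X} a g = X , a , ≤-antisym (d-≤ g)
          (≤-pred (subst (_≤ suc (d X D)) CD≡1+k (d-≤ (gcons a (d-gallery (gallery-source g) e)))))

  Between : Subset n → Subset n → Subset n → Set
  Between C D E = d C D + d D E ≡ d C E

  between? : ∀ C D E → Dec (Between C D E)
  between? C D E = d C D + d D E ≟ d C E

  between-target : ∀ {C E} → Chamber C → Chamber E → Between C E E
  between-target {C} {E} c e = trans (cong (d C E +_) (d-refl e)) (+-identityʳ (d C E))

  between-≤ : ∀ {C D E} → Between C D E → d C D ≤ d C E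
  between-≤ CDE = subst (_ ≤_) CDE (m≤m+n _ _)

  between-< : ∀ {C D E} → Chamber D → Chamber E → D ≢ E → Between C D E → d C D < d C E
  between-< e x D≢E CDE = subst (_ <_) CDE (m<m+n _ (n≢0⇒n>0 (D≢E ∘ d≡0⇒≡ e x)))

  adjacent-closer⇒between : ∀ {C X E} → Chamber C → Adjacent Δ X E → d C X < d C E →
                            Between C X E
  adjacent-closer⇒between {C} {X} {E} c X~E@(x , e , _) closer = ≤-antisym
    (subst (_≤ d C E) (sym (trans (cong (d C X +_) (d-adjacent X~E)) (+-comm (d C X) 1))) closer)
    (d-triangle c x e)

  module _ {C X Y Z} (c : Chamber C) (x : Chamber X) (y : Chamber Y) (z : Chamber Z)
           (CXY : Between C X Y) (CYZ : Between C Y Z) where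

    private
      chained : d C X + (d X Y + d Y Z) ≡ d C Z
      chained = trans (sym (+-assoc (d C X) _ _)) (trans (cong (_+ d Y Z) CXY) CYZ)

    between-trans : Between C X Z
    between-trans = ≤-antisym
      (subst (d C X + d X Z ≤_) chained (+-monoʳ-≤ (d C X) (d-triangle x y z)))
      (d-triangle c x z)

    between-shift : Between X Y Z
    between-shift = ≤-antisym
      (+-cancelˡ-≤ (d C X) _ _ (subst (_≤ d C X + d X Z) (sym chained) (d-triangle c x z)))
      (d-triangle x y z)

  ≤[]⇒between : ∀ {C D E} → Chamber C → Chamber D → Chamber E → _≤[_]_ Δ D C E → Between C D E
  ≤[]⇒between {C} {D} {E} c e x (k , g , geodesic , t) with through-split g t
  ... | k₁ , k₂ , g₁ , g₂ , k₁+k₂≡k = ≤-antisym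
    (subst (d C D + d D E ≤_) (trans k₁+k₂≡k (Dist⇒≡d geodesic)) (+-mono-≤ (d-≤ g₁) (d-≤ g₂)))
    (d-triangle c e x)

  between⇒≤[] : ∀ {C D E} → Chamber C → Chamber D → Chamber E → Between C D E → _≤[_]_ Δ D C E
  between⇒≤[] c e x CDE = _ , d-gallery c e ++ᵍ d-gallery e x
    , subst (Dist Δ _ _) (sym CDE) (d-dist c x) , through-++ (d-gallery c e) (d-gallery e x)

  s3 : S3 Δ
  s3 C D D₁ D₂ c e e₁ e₂ D≤D₁ D₁≤D₂ = between⇒≤[] e e₁ e₂
    (between-shift c e e₁ e₂ (≤[]⇒between c e e₁ D≤D₁) (≤[]⇒between c e₁ e₂ D₁≤D₂))

  IsGate : Subset n → Subset n → Subset n → Set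
  IsGate F C D = Chamber D × F ⊆ D × (∀ {E} → Chamber E → F ⊆ E → Between C D E)

  HasGates : Set
  HasGates = ∀ {F C} → Face F → Chamber C → ∃ (IsGate F C)

  IsGateMap : (Subset n → Subset n → Subset n) → Set
  IsGateMap π = ∀ {F C} → Face F → Chamber C → IsGate F C (π F C)

  gateProperty⇒hasGates : GateProperty Δ → HasGates
  gateProperty⇒hasGates gp {F} {C} f c with gp F C f c
  ... | D , e , F⊆D , additive =
    D , e , F⊆D , λ x F⊆E → sym (additive _ x F⊆E _ _ _ (d-dist c x) (d-dist c e) (d-dist e x))

  hasGates⇒gateProperty : HasGates → GateProperty Δ
  hasGates⇒gateProperty gates F C f c with gates f c
  ... | D , e , F⊆D , CDE = D , e , F⊆D , λ E x F⊆E _ _ _ CE CD DE →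
    trans (Dist⇒≡d CE) (trans (sym (CDE x F⊆E)) (cong₂ _+_ (sym (Dist⇒≡d CD)) (sym (Dist⇒≡d DE))))

  gate-nearest : ∀ {F C D E} → IsGate F C D → Chamber E → F ⊆ E → d C D ≤ d C E
  gate-nearest (_ , _ , via-D) x F⊆E = between-≤ (via-D x F⊆E)

  gate-unique : ∀ {F C D E} → IsGate F C D → Chamber E → F ⊆ E → d C E ≤ d C D → E ≡ D
  gate-unique {C = C} {D} (e , _ , via-D) x F⊆E CE≤CD =
    sym (d≡0⇒≡ e x (m+n≤m⇒n≡0 (d C D) (subst (_≤ d C D) (sym (via-D x F⊆E)) CE≤CD)))

  gate⇒minDistChamber : ∀ {F C D} → Chamber C → IsGate F C D → MinDistChamber Δ F C D
  gate⇒minDistChamber c gate@(e , F⊆D , _) = e , F⊆D , _ , d-dist c e ,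
    λ E x F⊆E m CE → subst (_ ≤_) (sym (Dist⇒≡d CE)) (gate-nearest gate x F⊆E)

  minDistChamber≡gate : ∀ {F C D D′} → Chamber C → IsGate F C D → MinDistChamber Δ F C D′ → D′ ≡ D
  minDistChamber≡gate c gate@(e , F⊆D , _) (e′ , F⊆D′ , _ , CD′ , nearest) = gate-unique gate e′ F⊆D′
    (subst (_≤ _) (Dist⇒≡d CD′) (nearest _ e F⊆D _ (d-dist c e)))

  gateMap : HasGates → Subset n → Subset n → Subset n
  gateMap gates F C with face? F | chamber? C
  ... | yes f | yes c = proj₁ (gates f c)
  ... | _     | _     = F

  gateMap-isGateMap : (gates : HasGates) → IsGateMap (gateMap gates)
  gateMap-isGateMap gates {F} {C} f c with face? F | chamber? C
  ... | yes f′ | yes c′ = proj₂ (gates f′ c′)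
  ... | no ¬f  | _      = contradiction f ¬f
  ... | yes _  | no ¬c  = contradiction c ¬c

  projection⇒isGateMap : ∀ {proj} → HasGates → IsProjection Δ proj → IsGateMap proj
  projection⇒isGateMap {proj} gates isProj {F} {C} f c with gates f c
  ... | D , gate = subst (IsGate F C) (proj₂ (isProj F C f c) D (gate⇒minDistChamber c gate)) gate

  module Gated (π : Subset n → Subset n → Subset n) (π-gate : IsGateMap π) where

    π-chamber : ∀ {F C} → Face F → Chamber C → Chamber (π F C)
    π-chamber f c = proj₁ (π-gate f c)

    π-⊇ : ∀ {F C} → Face F → Chamber C → F ⊆ π F C
    π-⊇ f c = proj₁ (proj₂ (π-gate f c))

    π-between : ∀ {F C E} → Face F → Chamber C → Chamber E → F ⊆ E → Between C (π F C) E
    π-between f c = proj₂ (proj₂ (π-gate f c))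

    π-self : ∀ {F C} → Face F → Chamber C → F ⊆ C → π F C ≡ C
    π-self {F} {C} f c F⊆C =
      sym (gate-unique (π-gate f c) c F⊆C (subst (_≤ d C (π F C)) (sym (d-refl c)) z≤n))

    π-intermediate : ∀ {F G C} → Face F → Face G → Chamber C → F ⊆ G → G ⊆ π F C →
                     π G C ≡ π F C
    π-intermediate f g c F⊆G G⊆πFC = sym (gate-unique (π-gate g c) (π-chamber f c) G⊆πFC
      (gate-nearest (π-gate f c) (π-chamber g c) (⊆-trans F⊆G (π-⊇ g c))))

    π-along-geodesic : ∀ {G C C₁} → Face G → Chamber C → Chamber C₁ → Between C C₁ (π G C) →
                       π G C₁ ≡ π G C
    π-along-geodesic {G} {C} {C₁} g c c₁ CC₁D =
      sym (gate-unique (π-gate g c₁) (π-chamber g c) (π-⊇ g c) (+-cancelˡ-≤ (d C C₁) _ _ ≤-chain))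
      where
      D = π G C
      Q = π G C₁
      q = π-chamber g c₁
      open ≤-Reasoning
      ≤-chain : d C C₁ + d C₁ D ≤ d C C₁ + d C₁ Q
      ≤-chain = begin
        d C C₁ + d C₁ D         ≤⟨ m≤m+n _ (d D Q) ⟩
        d C C₁ + d C₁ D + d D Q ≡⟨ cong (_+ d D Q) CC₁D ⟩
        d C D + d D Q           ≡⟨ π-between g c q (π-⊇ g c₁) ⟩
        d C Q                   ≤⟨ d-triangle c c₁ q ⟩
        d C C₁ + d C₁ Q         ∎

    convex : ∀ {F X Y Z} → Face F → Chamber X → Chamber Y → Chamber Z → F ⊆ X → F ⊆ Y →
             Between X Z Y → F ⊆ Z
    convex {F} {X} {Y} {Z} f x y z F⊆X F⊆Y XZY =
      subst (F ⊆_) (sym (d≡0⇒≡ z q (m+n≡0⇒m≡0 a (m+n≤n⇒m≡0 (a + a) 2a+XY≤XY)))) (π-⊇ f z)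
      where
      Q = π F Z
      q = π-chamber f z
      a = d Z Q
      open ≤-Reasoning
      2a+XY≤XY : (a + a) + d X Y ≤ d X Y
      2a+XY≤XY = begin
        (a + a) + d X Y           ≤⟨ +-monoʳ-≤ (a + a) (d-triangle x q y) ⟩
        (a + a) + (d X Q + d Q Y) ≡⟨ cong (λ t → (a + a) + (t + d Q Y)) (d-sym x q) ⟩
        (a + a) + (d Q X + d Q Y) ≡⟨ interchange a a (d Q X) (d Q Y) ⟩
        (a + d Q X) + (a + d Q Y) ≡⟨ cong₂ _+_ (π-between f z x F⊆X) (π-between f z y F⊆Y) ⟩
        d Z X + d Z Y             ≡⟨ cong (_+ d Z Y) (d-sym z x) ⟩
        d X Z + d Z Y             ≡⟨ XZY ⟩
        d X Y                     ∎

    closer-neighbour : ∀ {F C D} → Face F → Chamber C → Chamber D → F ⊆ D → π F C ≢ D →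
                       ∃[ X ] (Adjacent Δ X D × F ⊆ D ∩ X × Between C X D)
    closer-neighbour {F} {C} {D} f c e F⊆D πFC≢D with d D (π F C) in DP≡
    ... | zero  = contradiction (sym (d≡0⇒≡ e (π-chamber f c) DP≡)) πFC≢D
    ... | suc k with d-first-step e (π-chamber f c) DP≡
    ...   | X , D~X , XP≡k = X , X~D , (λ v∈F → x∈p∩q⁺ (F⊆D v∈F , F⊆X v∈F))
                           , adjacent-closer⇒between c X~D closer
      where
      P = π F C
      p = π-chamber f c
      X~D = adjacent-sym D~X
      x = proj₁ X~D
      F⊆X : F ⊆ X
      F⊆X = convex f e p x F⊆D (π-⊇ f c) (trans (cong₂ _+_ (d-adjacent D~X) XP≡k) (sym DP≡))
      open ≤-Reasoning
      closer : d C X < d C D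
      closer = begin-strict
        d C X         ≤⟨ d-triangle c p x ⟩
        d C P + d P X ≡⟨ cong (d C P +_) (trans (d-sym p x) XP≡k) ⟩
        d C P + k     <⟨ +-monoʳ-< (d C P) (n<1+n k) ⟩
        d C P + suc k ≡⟨ cong (d C P +_) (trans (sym DP≡) (d-sym e p)) ⟩
        d C P + d P D ≡⟨ π-between f c e F⊆D ⟩
        d C D         ∎

    isProjection : IsProjection Δ π
    isProjection F C f c =
      gate⇒minDistChamber c (π-gate f c) , λ D → minDistChamber≡gate c (π-gate f c)

    p1 : P1 Δ π
    p1 = (λ F C → π-⊇) , (λ F C → π-self) , (λ F G C → π-intermediate)

    p2 : P2 Δ π
    p2 F C D f c e F⊆D panels with π F C ≟ₛ D
    ... | yes πFC≡D = πFC≡D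
    ... | no πFC≢D with closer-neighbour f c e F⊆D πFC≢D
    ...   | X , X~D@(x , _ , X≢D , _) , F⊆D∩X , CXD = contradiction D≤X (<⇒≱ (between-< x e X≢D CXD))
      where
      g : Face (D ∩ X)
      g = face-⊆ (chamber-face e) (p∩q⊆p D X)
      D≤X : d C D ≤ d C X
      D≤X = subst (λ Y → d C Y ≤ d C X) (panels (D ∩ X) F⊆D∩X (adjacent⇒codimOne-∩ X~D))
              (gate-nearest (π-gate g c) x (p∩q⊆q D X))

    weakGallery-source : ∀ {C C₁ D} → WeakGallery Δ π C C₁ D → Chamber C₁
    weakGallery-source (wnil e)               = e
    weakGallery-source (wcons _ c₁ _ _ _ _ _) = c₁

    weakGallery-target : ∀ {C C₁ D} → WeakGallery Δ π C C₁ D → Chamber D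
    weakGallery-target (wnil e)              = e
    weakGallery-target (wcons _ _ _ _ _ _ w) = weakGallery-target w

    weakGallery-between : ∀ {C C₁ D} → Chamber C → WeakGallery Δ π C C₁ D → Between C C₁ D
    weakGallery-between c (wnil e) = between-target c e
    weakGallery-between c (wcons G c₁ g refl _ G⊆C₂ w) =
      between-trans c c₁ (weakGallery-source w) (weakGallery-target w)
        (π-between g c (weakGallery-source w) G⊆C₂) (weakGallery-between c w)

    p3 : P3 Δ π
    p3 F C C₁ D f c refl w = π-along-geodesic f c (weakGallery-source w) (weakGallery-between c w)

    s1 : S1 Δ
    s1 C F c f = π F C , minimal , unique , λ { refl → π-self f c ⊥⊆ }
      where
      minimal : MinimalIn Δ C F (π F C)
      minimal = π-chamber f c , π-⊇ f c , λ E x F⊆E E≤πFC →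
        gate-unique (π-gate f c) x F⊆E (between-≤ (≤[]⇒between c x (π-chamber f c) E≤πFC))
      unique : ∀ D′ → MinimalIn Δ C F D′ → D′ ≡ π F C
      unique D′ (e′ , F⊆D′ , minimal′) = sym (minimal′ (π F C) (π-chamber f c) (π-⊇ f c)
        (between⇒≤[] c (π-chamber f c) e′ (π-between f c e′ F⊆D′)))

    s2 : S2 Δ
    s2 C c L (order@(_ , members) , extension) =
      order , λ j 0<j → earlier-panel j 0<j , shared-panel j
      where
      chamber-at : ∀ i → Chamber (lookup L i)
      chamber-at i = Equivalence.from (members _) (∈-lookup i)

      shared-panel : ∀ j F → F ⊆ lookup L j → ∀ i → toℕ i < toℕ j → F ⊆ lookup L i →
                     ∃[ G ] (CodimOne Δ G (lookup L j) × F ⊆ G ×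
                             ∃[ k ] (toℕ k < toℕ j × G ⊆ lookup L k))
      shared-panel j F F⊆Lj i i<j F⊆Li with π F C ≟ₛ lookup L j
      ... | yes πFC≡Lj = contradiction (extension j i Lj≤Li) (<⇒≱ i<j)
        where
        f = face-⊆ (chamber-face (chamber-at j)) F⊆Lj
        Lj≤Li = between⇒≤[] c (chamber-at j) (chamber-at i)
                  (subst (λ D → Between C D (lookup L i)) πFC≡Lj (π-between f c (chamber-at i) F⊆Li))
      ... | no πFC≢Lj
        with closer-neighbour (face-⊆ (chamber-face (chamber-at j)) F⊆Lj) c (chamber-at j) F⊆Lj πFC≢Lj
      ...   | X , X~Lj@(x , _ , X≢Lj , _) , F⊆Lj∩X , CXLj =
        Lj ∩ X , adjacent⇒codimOne-∩ X~Lj , F⊆Lj∩X , k , k<j , subst (Lj ∩ X ⊆_) X≡Lk (p∩q⊆q Lj X)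
        where
        Lj = lookup L j
        X∈L = Equivalence.to (members X) x
        k = index X∈L
        X≡Lk : X ≡ lookup L k
        X≡Lk = lookup-index X∈L
        k≤j : toℕ k ≤ toℕ j
        k≤j = extension k j (subst (λ Y → _≤[_]_ Δ Y C Lj) X≡Lk (between⇒≤[] c x (chamber-at j) CXLj))
        k<j : toℕ k < toℕ j
        k<j = ≤∧≢⇒< k≤j λ k≡j → X≢Lj (trans X≡Lk (cong (lookup L) (toℕ-injective k≡j)))

      earlier-panel : ∀ j → 0 < toℕ j →
                      ∃[ G ] (CodimOne Δ G (lookup L j) × ∃[ k ] (toℕ k < toℕ j × G ⊆ lookup L k))
      earlier-panel j 0<j with shared-panel j ⊥ ⊥⊆ first first<j ⊥⊆
        where
        0<length = <-trans 0<j (toℕ<n j)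
        first = fromℕ< 0<length
        first<j = subst (_< toℕ j) (sym (toℕ-fromℕ< 0<length)) 0<j
      ... | G , G⋖Lj , _ , earlier = G , G⋖Lj , earlier

    module Restriction (R : Subset n → Subset n → Subset n) (isR : IsRestrictionMap Δ π R) where

      ∈R⇒ : ∀ {C D v} → Chamber C → Chamber D → v ∈ R C D → v ∈ D × π (D - v) C ≢ D
      ∈R⇒ c e = Equivalence.to (isR _ _ c e _)

      ⇒∈R : ∀ {C D v} → Chamber C → Chamber D → v ∈ D × π (D - v) C ≢ D → v ∈ R C D
      ⇒∈R c e = Equivalence.from (isR _ _ c e _)

      facet-face : ∀ {D} v → Chamber D → Face (D - v)
      facet-face {D} v e = face-⊆ (chamber-face e) (p─q⊆p D _)

      r1 : R1 Δ R
      r1 C D c e = Empty-unique (λ (v , v∈RCC) →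
                     proj₂ (∈R⇒ c c v∈RCC) (π-self (facet-face v c) c (p─q⊆p C _)))
                 , proj₁ ∘ ∈R⇒ c e

      R-π⊆ : ∀ {F C} → Face F → Chamber C → R C (π F C) ⊆ F
      R-π⊆ {F} {C} f c {v} v∈R with v ∈? F
      ... | yes v∈F = v∈F
      ... | no v∉F  = contradiction
        (π-intermediate f (facet-face v e) c F⊆D-v (p─q⊆p D _)) (proj₂ (∈R⇒ c e v∈R))
        where
        D = π F C
        e = π-chamber f c
        F⊆D-v : F ⊆ D - v
        F⊆D-v u∈F = x∈p∧x≢y⇒x∈p-y (π-⊇ f c u∈F) λ { refl → v∉F u∈F }

      R⊆⇒≡π : ∀ {F C D} → Face F → Chamber C → Chamber D → R C D ⊆ F → F ⊆ D → D ≡ π F C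
      R⊆⇒≡π {F} {C} {D} f c e R⊆F F⊆D = sym (p2 F C D f c e F⊆D panel)
        where
        panel : ∀ G → F ⊆ G → CodimOne Δ G D → π G C ≡ D
        panel G F⊆G (G⊆D , G⋖D) with p⊆q∧1+∣p∣≡∣q∣⇒p≡q-x G⊆D G⋖D
        ... | v , v∈D , v∉G , refl = decidable-stable (π (D - v) C ≟ₛ D)
                λ π≢D → v∉G (F⊆G (R⊆F (⇒∈R c e (v∈D , π≢D))))

      r2 : R2 Δ R
      r2 C F c f = π F C , (π-chamber f c , R-π⊆ f c , π-⊇ f c) , λ D′ e′ → R⊆⇒≡π f c e′

      R⊆⇒between : ∀ {C X Y} → Chamber C → Chamber X → Chamber Y → R C X ⊆ Y → Between C X Y
      R⊆⇒between {C} {X} {Y} c x y R⊆Y =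
        subst (λ Z → Between C Z Y) (sym X≡π) (π-between g c y (p∩q⊆q X Y))
        where
        g = face-⊆ (chamber-face x) (p∩q⊆p X Y)
        X≡π = R⊆⇒≡π g c x (λ v∈R → x∈p∩q⁺ (proj₂ (r1 C X c x) v∈R , R⊆Y v∈R)) (p∩q⊆p X Y)

      rChain-source : ∀ {C C₁ D} → RChain Δ R C C₁ D → Chamber C₁
      rChain-source (rnil e)       = e
      rChain-source (rcons c₁ _ _) = c₁

      rChain-target : ∀ {C C₁ D} → RChain Δ R C C₁ D → Chamber D
      rChain-target (rnil e)         = e
      rChain-target (rcons _ _ rest) = rChain-target rest

      rChain-between : ∀ {C C₁ D} → Chamber C → RChain Δ R C C₁ D → Between C C₁ D
      rChain-between c (rnil e) = between-target c e
      rChain-between c (rcons c₁ R⊆C₂ rest) =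
        between-trans c c₁ (rChain-source rest) (rChain-target rest)
          (R⊆⇒between c c₁ (rChain-source rest) R⊆C₂) (rChain-between c rest)

      r3 : R3 Δ R
      r3 C C₁ D c chain = R₁⊆R , proj₂ (r1 C D c e)
        where
        e = rChain-target chain
        c₁ = rChain-source chain
        CC₁D = rChain-between c chain
        R₁⊆R : R C₁ D ⊆ R C D
        R₁⊆R {v} v∈R₁ with ∈R⇒ c₁ e v∈R₁
        ... | v∈D , π₁≢D = ⇒∈R c e (v∈D , λ π≡D → π₁≢D (trans
          (π-along-geodesic (facet-face v e) c c₁ (subst (Between C C₁) (sym π≡D) CC₁D))
          π≡D))

      restrictionAxioms : RestrictionAxioms Δ R
      restrictionAxioms = r1 , r2 , r3

  -- A constructive rendering of: D is the only ≤_C-minimal chamber containing F.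
  IsOnlyMinimal : Subset n → Subset n → Subset n → Set
  IsOnlyMinimal F C D = ∀ {E} → Chamber E → F ⊆ E → E ≢ D →
                        ∃[ E′ ] (Chamber E′ × F ⊆ E′ × E′ ≢ E × Between C E′ E)

  onlyMinimal⇒gate : ∀ {F C D} → Chamber C → Chamber D → F ⊆ D → IsOnlyMinimal F C D → IsGate F C D
  onlyMinimal⇒gate {F} {C} {D} c e F⊆D descend = e , F⊆D , λ {E} x → go E (<-wellFounded _) x
    where
    go : ∀ E → Acc _<_ (d C E) → Chamber E → F ⊆ E → Between C D E
    go E (acc nearer) x F⊆E with E ≟ₛ D
    ... | yes refl = between-target c x
    ... | no E≢D with descend x F⊆E E≢D
    ...   | E′ , x′ , F⊆E′ , E′≢E , CE′E = between-trans c e x′ x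
            (go E′ (nearer (between-< x′ x E′≢E CE′E)) x′ F⊆E′) CE′E

  shelling⇒hasGates : S1 Δ → HasGates
  shelling⇒hasGates s1 {F} {C} f c with s1 C F c f
  ... | D , (e , F⊆D , _) , unique , _ = D , onlyMinimal⇒gate c e F⊆D descend
    where
    descend : IsOnlyMinimal F C D
    descend {E} x F⊆E E≢D
      with anySubset? (λ E′ → chamber? E′ ×-dec F ⊆? E′ ×-dec ¬? (E′ ≟ₛ E) ×-dec between? C E′ E)
    ... | yes found = found
    ... | no none   = contradiction (unique E (x , F⊆E , λ E′ x′ F⊆E′ E′≤E →
            decidable-stable (E′ ≟ₛ E) λ E′≢E →
              none (E′ , x′ , F⊆E′ , E′≢E , ≤[]⇒between c x′ x E′≤E)))
          E≢D

  minDistChamber-≤ : ∀ {G C D E} → Chamber C → MinDistChamber Δ G C D →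
                     Chamber E → G ⊆ E → d C E ≤ d C D → MinDistChamber Δ G C E
  minDistChamber-≤ {C = C} {E = E} c (_ , _ , _ , CD , nearest) x G⊆E CE≤CD =
    x , G⊆E , d C E , d-dist c x , λ E′ x′ G⊆E′ m CE′ →
      ≤-trans CE≤CD (subst (_≤ m) (Dist⇒≡d CD) (nearest E′ x′ G⊆E′ m CE′))

  projection-of-panel : ∀ {proj G C E} → IsProjection Δ proj → Chamber C → Chamber E →
                        CodimOne Δ G E → proj G C ≢ E →
                        Chamber (proj G C) × G ⊆ proj G C × Between C (proj G C) E
  projection-of-panel {proj} {G} {C} {E} isProj c x G⋖E E₁≢E
    with isProj G C (face-⊆ (chamber-face x) (proj₁ G⋖E)) c
  ... | nearest@(e₁ , G⊆E₁ , _) , unique = e₁ , G⊆E₁ , adjacent-closer⇒between c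
    (common-panel⇒adjacent e₁ x E₁≢E G⊆E₁ G⋖E)
    (≰⇒> λ CE≤CE₁ → E₁≢E (sym (unique E (minDistChamber-≤ c nearest x (proj₁ G⋖E) CE≤CE₁))))

  projection⇒hasGates : ∀ {proj} → IsProjection Δ proj → P2 Δ proj → HasGates
  projection⇒hasGates {proj} isProj panels {F} {C} f c with proj₁ (isProj F C f c)
  ... | e , F⊆D , _ = proj F C , onlyMinimal⇒gate c e F⊆D descend
    where
    descend : IsOnlyMinimal F C (proj F C)
    descend {E} x F⊆E E≢D with anySubset? (λ G → F ⊆? G ×-dec codimOne? G E ×-dec ¬? (proj G C ≟ₛ E))
    ... | no none = contradiction (sym (panels F C E f c x F⊆E λ G F⊆G G⋖E →
            decidable-stable (proj G C ≟ₛ E) λ πGC≢E → none (G , F⊆G , G⋖E , πGC≢E))) E≢D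
    ... | yes (G , F⊆G , G⋖E , E₁≢E) with projection-of-panel isProj c x G⋖E E₁≢E
    ...   | e₁ , G⊆E₁ , CE₁E = proj G C , e₁ , ⊆-trans F⊆G G⊆E₁ , E₁≢E , CE₁E

theorem6p2 : (Δ : SimplicialComplex) → IsChamberComplex Δ →
    let S = Subset (SimplicialComplex.n Δ) in
    (GateProperty Δ ⇔ ShellingAxioms Δ)
    × (GateProperty Δ ⇔
         (Σ (S → S → S) λ proj → IsProjection Δ proj × ProjectionAxioms Δ proj))
    × (GateProperty Δ →
         ∀ (proj : S → S → S) → IsProjection Δ proj →
         ∀ (R : S → S → S) → IsRestrictionMap Δ proj R → RestrictionAxioms Δ R)
theorem6p2 Δ (pure , connected) =
    mk⇔ (λ gp → let open Gated (gateMap (gates gp)) (gateMap-isGateMap (gates gp))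
                in s1 , s2 , s3)
        (λ (s1 , _) → hasGates⇒gateProperty (shelling⇒hasGates s1))
  , mk⇔ (λ gp → let open Gated (gateMap (gates gp)) (gateMap-isGateMap (gates gp))
                in gateMap (gates gp) , isProjection , p1 , p2 , p3)
        (λ (_ , isProj , _ , p2 , _) → hasGates⇒gateProperty (projection⇒hasGates isProj p2))
  , λ gp proj isProj R isR →
      Gated.Restriction.restrictionAxioms proj (projection⇒isGateMap (gates gp) isProj) R isR
  where
  open ChamberComplex Δ pure connected
  gates : GateProperty Δ → HasGates
  gates = gateProperty⇒hasGates
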